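{- Let $p$ and $r$ be coupled cubic Galois polynomials, let $\alpha,\beta\in\mathbb{Q}$ with $\alpha\neq 0$, and set $g(x)=p(\alpha x+\beta)$ and $h(x)=r(\alpha x+\beta)$. Then $g$ and $h$ are coupled cubic Galois polynomials.
   Context: A cubic Galois polynomial is an irreducible cubic polynomial with rational coefficients whose Galois group over $\mathbb{Q}$ is the cyclic group $A_3$. A quadratic polynomial $q\in\mathbb{Q}[x]$ cyclically permutes the roots of a cubic polynomial if its roots can be enumerated $x_1,x_2,x_3$ so that $q(x_1)=x_2$, $q(x_2)=x_3$, $q(x_3)=x_1$. Two cubic Galois polynomials are coupled if there exists a quadratic polynomial $q\in\mathbb{Q}[x]$ that cyclically permutes the roots of both of them. -}

module Defs where

open import Level using (0ℓ)
open import Data.Nat using (ℕ; zero; suc; _<_)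
open import Data.Fin using (Fin)
import Data.Fin as Fin
open import Data.Fin.Permutation using (Permutation′; _⟨$⟩ʳ_)
open import Data.List using (List; []; _∷_; foldr; map)
open import Data.Product using (Σ; _×_; _,_)
open import Data.Sum using (_⊎_)
open import Relation.Nullary using (¬_)
open import Relation.Binary.PropositionalEquality using (_≡_)
open import Function.Bundles using (_⇔_)
open import Algebra.Bundles using (CommutativeRing)
open import Algebra.Morphism.Structures using (module RingMorphisms)
open import Data.Rational using (ℚ; 0ℚ; 1ℚ)
import Data.Rational as ℚ
import Data.Rational.Properties as ℚP

-- Polynomials with rational coefficients, as little-endian coefficient
-- lists: a₀ ∷ a₁ ∷ … represents a₀ + a₁ x + … .

Poly : Set
Poly = List ℚ

coeff : Poly → ℕ → ℚ
coeff []      _       = 0ℚ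
coeff (a ∷ p) zero    = a
coeff (a ∷ p) (suc n) = coeff p n

-- equality of polynomials (coefficientwise; ignores trailing zeros)
_≐_ : Poly → Poly → Set
p ≐ q = ∀ n → coeff p n ≡ coeff q n

Degree : Poly → ℕ → Set
Degree p n = (¬ coeff p n ≡ 0ℚ) × (∀ k → n < k → coeff p k ≡ 0ℚ)

infixl 6 _+ₚ_
infixl 7 _*ₚ_

_+ₚ_ : Poly → Poly → Poly
[]      +ₚ q       = q
(a ∷ p) +ₚ []      = a ∷ p
(a ∷ p) +ₚ (b ∷ q) = (a ℚ.+ b) ∷ (p +ₚ q)

scaleₚ : ℚ → Poly → Poly
scaleₚ c p = map (c ℚ.*_) p

_*ₚ_ : Poly → Poly → Poly
[]      *ₚ q = []
(a ∷ p) *ₚ q = scaleₚ a q +ₚ (0ℚ ∷ (p *ₚ q))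

_∘ₚ_ : Poly → Poly → Poly
p ∘ₚ s = foldr (λ c acc → (c ∷ []) +ₚ (s *ₚ acc)) [] p

linearₚ : ℚ → ℚ → Poly
linearₚ α β = β ∷ α ∷ []

Irreducible : Poly → Set
Irreducible p =
  (Σ ℕ λ d → Degree p (suc d)) ×
  (∀ f g m n → Degree f m → Degree g n → p ≐ (f *ₚ g) → m ≡ 0 ⊎ n ≡ 0)

-- A field K of characteristic 0, given together with the (unique)
-- embedding ι : ℚ → K (a unital ring homomorphism).  All roots are
-- taken in such a field K (e.g. ℂ or an algebraic closure of ℚ).

record FieldOverℚ : Set₁ where
  field
    cring    : CommutativeRing 0ℓ 0ℓ
  open CommutativeRing cring public hiding (ring)
  field
    1≉0      : ¬ (1# ≈ 0#)
    inverse  : ∀ x → ¬ (x ≈ 0#) → Σ Carrier λ y → (x * y) ≈ 1#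
    ι        : ℚ → Carrier
    ι-hom    : RingMorphisms.IsRingHomomorphism ℚP.+-*-rawRing rawRing ι

module _ (K : FieldOverℚ) where
  open FieldOverℚ K

  evalK : Poly → Carrier → Carrier
  evalK p t = foldr (λ c acc → ι c + (t * acc)) 0# p

  RootsOf : Poly → (Fin 3 → Carrier) → Set
  RootsOf p x = ∀ t → evalK p t ≈
    (ι (coeff p 3) * (((t - x (Fin.zero)) * (t - x (Fin.suc Fin.zero)))
                        * (t - x (Fin.suc (Fin.suc Fin.zero)))))

  data MExpr : Set where
    cst : ℚ → MExpr
    var : Fin 3 → MExpr
    _⊕_ : MExpr → MExpr → MExpr
    _⊗_ : MExpr → MExpr → MExpr

  evalM : (Fin 3 → Carrier) → MExpr → Carrier
  evalM x (cst c)   = ι c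
  evalM x (var i)   = x i
  evalM x (e ⊕ e′)  = evalM x e + evalM x e′
  evalM x (e ⊗ e′)  = evalM x e * evalM x e′

  -- σ belongs to the Galois group of the roots x (viewed as a group of
  -- permutations of the roots): σ preserves every algebraic relation
  -- over ℚ among the roots.
  InGalois : (Fin 3 → Carrier) → Permutation′ 3 → Set
  InGalois x σ = ∀ (F : MExpr) → evalM x F ≈ 0# →
                 evalM (λ i → x (σ ⟨$⟩ʳ i)) F ≈ 0#

next : Fin 3 → Fin 3
next Fin.zero                     = Fin.suc Fin.zero
next (Fin.suc Fin.zero)           = Fin.suc (Fin.suc Fin.zero)
next (Fin.suc (Fin.suc Fin.zero)) = Fin.zero

InA3 : Permutation′ 3 → Set
InA3 σ = (∀ i → σ ⟨$⟩ʳ i ≡ i)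
       ⊎ (∀ i → σ ⟨$⟩ʳ i ≡ next i)
       ⊎ (∀ i → σ ⟨$⟩ʳ i ≡ next (next i))

module _ (K : FieldOverℚ) where
  open FieldOverℚ K

  CubicGalois : Poly → Set
  CubicGalois p =
    Degree p 3 × Irreducible p ×
    Σ (Fin 3 → Carrier) λ x → RootsOf K p x ×
      (∀ σ → InGalois K x σ ⇔ InA3 σ)

  CyclicallyPermutes : Poly → Poly → Set
  CyclicallyPermutes q p =
    Σ (Fin 3 → Carrier) λ x → RootsOf K p x ×
      (∀ i → evalK K q (x i) ≈ x (next i))

  Coupled : Poly → Poly → Set
  Coupled p r = Σ Poly λ q → Degree q 2 ×
    CyclicallyPermutes q p × CyclicallyPermutes q r

{-# OPTIONS --safe #-}
module Submission where

open import Defs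
open import Data.Product using (_×_)
open import Relation.Nullary using (¬_)
open import Relation.Binary.PropositionalEquality using (_≡_)
open import Data.Rational using (ℚ; 0ℚ)

-- Substituting αx + β for x (α ≠ 0) is an automorphism L of ℚ[x], with
-- inverse L⁻¹ = α⁻¹x − α⁻¹β, which preserves degrees; so a factorisation of
-- p ∘ L pulls back along L⁻¹ to one of p, and irreducibility is preserved.
-- If x₀, x₁, x₂ are the roots of p then y_i = L⁻¹(x_i) are the roots of
-- p ∘ L.  Each family is a rational polynomial image of the other, so they
-- satisfy the same algebraic relations under any permutation and have the
-- same Galois group.  Finally, if q cyclically permutes the roots of p and
-- of r, then L⁻¹ ∘ q ∘ L is again quadratic and cyclically permutes the
-- roots of p ∘ L and of r ∘ L.

open import Level using (0ℓ)
open import Function using (_∘_)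
open import Function.Bundles using (mk⇔; Equivalence)
open import Data.Nat using (ℕ; zero; suc)
open import Data.Fin using (Fin)
open import Data.Fin.Patterns using (0F; 1F; 2F)
open import Data.Fin.Permutation using (_⟨$⟩ʳ_)
open import Data.List using ([]; _∷_; map; foldr)
open import Data.Product using (_,_; proj₁; proj₂)
open import Data.Sum using (_⊎_)
open import Data.Rational using (1ℚ)
import Data.Rational as ℚ
import Data.Rational.Properties as ℚP
import Relation.Binary.PropositionalEquality as ≡
open import Relation.Binary.Bundles using (Setoid)
open import Relation.Binary.Structures using (IsEquivalence)
import Relation.Binary.Reasoning.Setoid as SetoidReasoning
open import Algebra.Bundles using (CommutativeMonoid; CommutativeRing; Semiring)
import Algebra.Structures as Structures
open import Algebra.Morphism.Structures using (module RingMorphisms)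
open import Algebra.Consequences.Setoid using (comm∧idˡ⇒id; comm∧invˡ⇒inv; comm∧distrʳ⇒distr)
import Algebra.Properties.CommutativeSemigroup as CommutativeSemigroupProperties

-- The ring of polynomials

module _ where
  open import Data.Rational using (_+_; _*_; -_)
  open ≡ using (refl; cong; cong₂)
  open ≡.≡-Reasoning

  -- A record rather than _≐_ itself, so that unification can recover
  -- the two polynomials from an equation between them.
  infix 4 _≈ₚ_
  record _≈ₚ_ (p q : Poly) : Set where
    constructor coeffwise
    field coeff≡ : p ≐ q
  open _≈ₚ_ public

  ≈ₚ-isEquivalence : IsEquivalence _≈ₚ_
  ≈ₚ-isEquivalence = record
    { refl  = coeffwise λ _ → refl
    ; sym   = λ (coeffwise p≐q) → coeffwise λ n → ≡.sym (p≐q n)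
    ; trans = λ (coeffwise p≐q) (coeffwise q≐r) → coeffwise λ n → ≡.trans (p≐q n) (q≐r n)
    }

  ≈ₚ-setoid : Setoid 0ℓ 0ℓ
  ≈ₚ-setoid = record { isEquivalence = ≈ₚ-isEquivalence }

  open Setoid ≈ₚ-setoid public using () renaming (refl to ≈ₚ-refl; sym to ≈ₚ-sym; trans to ≈ₚ-trans)

  ∷-cong : ∀ {a b p q} → a ≡ b → p ≈ₚ q → a ∷ p ≈ₚ b ∷ q
  ∷-cong a≡b (coeffwise p≐q) = coeffwise λ where
    zero    → a≡b
    (suc n) → p≐q n

  0∷[]≈ₚ[] : 0ℚ ∷ [] ≈ₚ []
  0∷[]≈ₚ[] = coeffwise λ where
    zero    → refl
    (suc n) → refl

  -ₚ_ : Poly → Poly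
  -ₚ_ = map -_

  constₚ : ℚ → Poly
  constₚ c = c ∷ []

  Xₚ : Poly
  Xₚ = 0ℚ ∷ 1ℚ ∷ []

  coeff-+ₚ : ∀ p q n → coeff (p +ₚ q) n ≡ coeff p n + coeff q n
  coeff-+ₚ []      q       n       = ≡.sym (ℚP.+-identityˡ (coeff q n))
  coeff-+ₚ (a ∷ p) []      n       = ≡.sym (ℚP.+-identityʳ (coeff (a ∷ p) n))
  coeff-+ₚ (a ∷ p) (b ∷ q) zero    = refl
  coeff-+ₚ (a ∷ p) (b ∷ q) (suc n) = coeff-+ₚ p q n

  coeff-scaleₚ : ∀ c p n → coeff (scaleₚ c p) n ≡ c * coeff p n
  coeff-scaleₚ c []      n       = ≡.sym (ℚP.*-zeroʳ c)
  coeff-scaleₚ c (a ∷ p) zero    = refl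
  coeff-scaleₚ c (a ∷ p) (suc n) = coeff-scaleₚ c p n

  coeff--ₚ : ∀ p n → coeff (-ₚ p) n ≡ - coeff p n
  coeff--ₚ []      n       = refl
  coeff--ₚ (a ∷ p) zero    = refl
  coeff--ₚ (a ∷ p) (suc n) = coeff--ₚ p n

  +ₚ-cong : ∀ {p p′ q q′} → p ≈ₚ p′ → q ≈ₚ q′ → p +ₚ q ≈ₚ p′ +ₚ q′
  +ₚ-cong {p} {p′} {q} {q′} (coeffwise p≐p′) (coeffwise q≐q′) = coeffwise λ n → begin
    coeff (p +ₚ q) n        ≡⟨ coeff-+ₚ p q n ⟩
    coeff p n + coeff q n   ≡⟨ cong₂ _+_ (p≐p′ n) (q≐q′ n) ⟩
    coeff p′ n + coeff q′ n ≡⟨ coeff-+ₚ p′ q′ n ⟨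
    coeff (p′ +ₚ q′) n      ∎

  +ₚ-assoc : ∀ p q r → (p +ₚ q) +ₚ r ≈ₚ p +ₚ (q +ₚ r)
  +ₚ-assoc p q r = coeffwise λ n → begin
    coeff ((p +ₚ q) +ₚ r) n             ≡⟨ coeff-+ₚ (p +ₚ q) r n ⟩
    coeff (p +ₚ q) n + coeff r n        ≡⟨ cong (_+ coeff r n) (coeff-+ₚ p q n) ⟩
    (coeff p n + coeff q n) + coeff r n ≡⟨ ℚP.+-assoc (coeff p n) (coeff q n) (coeff r n) ⟩
    coeff p n + (coeff q n + coeff r n) ≡⟨ cong (coeff p n +_) (coeff-+ₚ q r n) ⟨
    coeff p n + coeff (q +ₚ r) n        ≡⟨ coeff-+ₚ p (q +ₚ r) n ⟨
    coeff (p +ₚ (q +ₚ r)) n             ∎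

  +ₚ-comm : ∀ p q → p +ₚ q ≈ₚ q +ₚ p
  +ₚ-comm p q = coeffwise λ n → begin
    coeff (p +ₚ q) n      ≡⟨ coeff-+ₚ p q n ⟩
    coeff p n + coeff q n ≡⟨ ℚP.+-comm (coeff p n) (coeff q n) ⟩
    coeff q n + coeff p n ≡⟨ coeff-+ₚ q p n ⟨
    coeff (q +ₚ p) n      ∎

  -ₚ‿cong : ∀ {p q} → p ≈ₚ q → -ₚ p ≈ₚ -ₚ q
  -ₚ‿cong {p} {q} (coeffwise p≐q) = coeffwise λ n → begin
    coeff (-ₚ p) n ≡⟨ coeff--ₚ p n ⟩
    - coeff p n    ≡⟨ cong -_ (p≐q n) ⟩
    - coeff q n    ≡⟨ coeff--ₚ q n ⟨
    coeff (-ₚ q) n ∎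

  -ₚ‿inverseˡ : ∀ p → (-ₚ p) +ₚ p ≈ₚ []
  -ₚ‿inverseˡ p = coeffwise λ n → begin
    coeff ((-ₚ p) +ₚ p) n      ≡⟨ coeff-+ₚ (-ₚ p) p n ⟩
    coeff (-ₚ p) n + coeff p n ≡⟨ cong (_+ coeff p n) (coeff--ₚ p n) ⟩
    - coeff p n + coeff p n    ≡⟨ ℚP.+-inverseˡ (coeff p n) ⟩
    0ℚ                         ∎

  +ₚ-isCommutativeMonoid : Structures.IsCommutativeMonoid _≈ₚ_ _+ₚ_ []
  +ₚ-isCommutativeMonoid = record
    { isMonoid = record
      { isSemigroup = record
        { isMagma = record { isEquivalence = ≈ₚ-isEquivalence ; ∙-cong = +ₚ-cong }
        ; assoc   = +ₚ-assoc
        }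
      ; identity = comm∧idˡ⇒id ≈ₚ-setoid +ₚ-comm (λ _ → ≈ₚ-refl)
      }
    ; comm = +ₚ-comm
    }

  +ₚ-commutativeMonoid : CommutativeMonoid 0ℓ 0ℓ
  +ₚ-commutativeMonoid = record { isCommutativeMonoid = +ₚ-isCommutativeMonoid }

  open CommutativeMonoid +ₚ-commutativeMonoid public using () renaming (identityʳ to +ₚ-identityʳ)

  +ₚ-congˡ : ∀ p {q q′} → q ≈ₚ q′ → p +ₚ q ≈ₚ p +ₚ q′
  +ₚ-congˡ p = +ₚ-cong (≈ₚ-refl {p})

  +ₚ-congʳ : ∀ {p p′} q → p ≈ₚ p′ → p +ₚ q ≈ₚ p′ +ₚ q
  +ₚ-congʳ q p≈p′ = +ₚ-cong p≈p′ (≈ₚ-refl {q})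

  open CommutativeSemigroupProperties (CommutativeMonoid.commutativeSemigroup +ₚ-commutativeMonoid) public
    using () renaming (interchange to +ₚ-interchange; x∙yz≈y∙xz to +ₚ-x∙yz≈y∙xz)

  scaleₚ-cong : ∀ c {p q} → p ≈ₚ q → scaleₚ c p ≈ₚ scaleₚ c q
  scaleₚ-cong c {p} {q} (coeffwise p≐q) = coeffwise λ n → begin
    coeff (scaleₚ c p) n ≡⟨ coeff-scaleₚ c p n ⟩
    c * coeff p n        ≡⟨ cong (c *_) (p≐q n) ⟩
    c * coeff q n        ≡⟨ coeff-scaleₚ c q n ⟨
    coeff (scaleₚ c q) n ∎

  scaleₚ-distribˡ : ∀ c p q → scaleₚ c (p +ₚ q) ≈ₚ scaleₚ c p +ₚ scaleₚ c q
  scaleₚ-distribˡ c p q = coeffwise λ n → begin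
    coeff (scaleₚ c (p +ₚ q)) n                   ≡⟨ coeff-scaleₚ c (p +ₚ q) n ⟩
    c * coeff (p +ₚ q) n                          ≡⟨ cong (c *_) (coeff-+ₚ p q n) ⟩
    c * (coeff p n + coeff q n)                   ≡⟨ ℚP.*-distribˡ-+ c (coeff p n) (coeff q n) ⟩
    c * coeff p n + c * coeff q n                 ≡⟨ cong₂ _+_ (coeff-scaleₚ c p n) (coeff-scaleₚ c q n) ⟨
    coeff (scaleₚ c p) n + coeff (scaleₚ c q) n   ≡⟨ coeff-+ₚ (scaleₚ c p) (scaleₚ c q) n ⟨
    coeff (scaleₚ c p +ₚ scaleₚ c q) n            ∎

  scaleₚ-distribʳ : ∀ a b p → scaleₚ (a + b) p ≈ₚ scaleₚ a p +ₚ scaleₚ b p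
  scaleₚ-distribʳ a b p = coeffwise λ n → begin
    coeff (scaleₚ (a + b) p) n                    ≡⟨ coeff-scaleₚ (a + b) p n ⟩
    (a + b) * coeff p n                           ≡⟨ ℚP.*-distribʳ-+ (coeff p n) a b ⟩
    a * coeff p n + b * coeff p n                 ≡⟨ cong₂ _+_ (coeff-scaleₚ a p n) (coeff-scaleₚ b p n) ⟨
    coeff (scaleₚ a p) n + coeff (scaleₚ b p) n   ≡⟨ coeff-+ₚ (scaleₚ a p) (scaleₚ b p) n ⟨
    coeff (scaleₚ a p +ₚ scaleₚ b p) n            ∎

  scaleₚ-assoc : ∀ a b p → scaleₚ (a * b) p ≈ₚ scaleₚ a (scaleₚ b p)
  scaleₚ-assoc a b p = coeffwise λ n → begin
    coeff (scaleₚ (a * b) p) n      ≡⟨ coeff-scaleₚ (a * b) p n ⟩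
    (a * b) * coeff p n             ≡⟨ ℚP.*-assoc a b (coeff p n) ⟩
    a * (b * coeff p n)             ≡⟨ cong (a *_) (coeff-scaleₚ b p n) ⟨
    a * coeff (scaleₚ b p) n        ≡⟨ coeff-scaleₚ a (scaleₚ b p) n ⟨
    coeff (scaleₚ a (scaleₚ b p)) n ∎

  scaleₚ-zero : ∀ p → scaleₚ 0ℚ p ≈ₚ []
  scaleₚ-zero p = coeffwise λ n → ≡.trans (coeff-scaleₚ 0ℚ p n) (ℚP.*-zeroˡ (coeff p n))

  scaleₚ-identity : ∀ p → scaleₚ 1ℚ p ≈ₚ p
  scaleₚ-identity p = coeffwise λ n → ≡.trans (coeff-scaleₚ 1ℚ p n) (ℚP.*-identityˡ (coeff p n))

module _ where
  open import Data.Rational using (_+_; _*_)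
  open ≡ using (refl; cong)
  open SetoidReasoning ≈ₚ-setoid

  *ₚ-congʳ : ∀ p {q q′} → q ≈ₚ q′ → p *ₚ q ≈ₚ p *ₚ q′
  *ₚ-congʳ []      q≈q′ = ≈ₚ-refl
  *ₚ-congʳ (a ∷ p) q≈q′ = +ₚ-cong (scaleₚ-cong a q≈q′) (∷-cong refl (*ₚ-congʳ p q≈q′))

  *ₚ-zeroʳ : ∀ p → p *ₚ [] ≈ₚ []
  *ₚ-zeroʳ []      = ≈ₚ-refl
  *ₚ-zeroʳ (a ∷ p) = ≈ₚ-trans (∷-cong refl (*ₚ-zeroʳ p)) 0∷[]≈ₚ[]

  *ₚ-∷ʳ : ∀ q a p → q *ₚ (a ∷ p) ≈ₚ scaleₚ a q +ₚ (0ℚ ∷ q *ₚ p)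
  *ₚ-∷ʳ []      a p = ≈ₚ-sym 0∷[]≈ₚ[]
  *ₚ-∷ʳ (b ∷ q) a p = ∷-cong (cong (_+ 0ℚ) (ℚP.*-comm b a)) (begin
    scaleₚ b p +ₚ q *ₚ (a ∷ p)                       ≈⟨ +ₚ-congˡ (scaleₚ b p) (*ₚ-∷ʳ q a p) ⟩
    scaleₚ b p +ₚ (scaleₚ a q +ₚ (0ℚ ∷ q *ₚ p))      ≈⟨ +ₚ-x∙yz≈y∙xz (scaleₚ b p) (scaleₚ a q) _ ⟩
    scaleₚ a q +ₚ (scaleₚ b p +ₚ (0ℚ ∷ q *ₚ p))      ∎)

  *ₚ-comm : ∀ p q → p *ₚ q ≈ₚ q *ₚ p
  *ₚ-comm []      q = ≈ₚ-sym (*ₚ-zeroʳ q)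
  *ₚ-comm (a ∷ p) q = begin
    scaleₚ a q +ₚ (0ℚ ∷ p *ₚ q) ≈⟨ +ₚ-congˡ (scaleₚ a q) (∷-cong refl (*ₚ-comm p q)) ⟩
    scaleₚ a q +ₚ (0ℚ ∷ q *ₚ p) ≈⟨ *ₚ-∷ʳ q a p ⟨
    q *ₚ (a ∷ p)                ∎

  *ₚ-congˡ : ∀ {p p′} q → p ≈ₚ p′ → p *ₚ q ≈ₚ p′ *ₚ q
  *ₚ-congˡ {p} {p′} q p≈p′ = begin
    p *ₚ q  ≈⟨ *ₚ-comm p q ⟩
    q *ₚ p  ≈⟨ *ₚ-congʳ q p≈p′ ⟩
    q *ₚ p′ ≈⟨ *ₚ-comm q p′ ⟩
    p′ *ₚ q ∎

  scaleₚ-*ₚ : ∀ c p q → scaleₚ c p *ₚ q ≈ₚ scaleₚ c (p *ₚ q)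
  scaleₚ-*ₚ c []      q = ≈ₚ-refl
  scaleₚ-*ₚ c (b ∷ p) q = begin
    scaleₚ (c * b) q +ₚ (0ℚ ∷ scaleₚ c p *ₚ q)
      ≈⟨ +ₚ-cong (scaleₚ-assoc c b q) (∷-cong (≡.sym (ℚP.*-zeroʳ c)) (scaleₚ-*ₚ c p q)) ⟩
    scaleₚ c (scaleₚ b q) +ₚ scaleₚ c (0ℚ ∷ p *ₚ q)
      ≈⟨ scaleₚ-distribˡ c (scaleₚ b q) (0ℚ ∷ p *ₚ q) ⟨
    scaleₚ c (scaleₚ b q +ₚ (0ℚ ∷ p *ₚ q))
      ∎

  0∷-*ₚ : ∀ p q → (0ℚ ∷ p) *ₚ q ≈ₚ 0ℚ ∷ p *ₚ q
  0∷-*ₚ p q = +ₚ-congʳ (0ℚ ∷ p *ₚ q) (scaleₚ-zero q)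

  *ₚ-distribʳ : ∀ w u v → (u +ₚ v) *ₚ w ≈ₚ u *ₚ w +ₚ v *ₚ w
  *ₚ-distribʳ w []      v       = ≈ₚ-refl
  *ₚ-distribʳ w (a ∷ u) []      = ≈ₚ-sym (+ₚ-identityʳ ((a ∷ u) *ₚ w))
  *ₚ-distribʳ w (a ∷ u) (b ∷ v) = begin
    scaleₚ (a + b) w +ₚ (0ℚ ∷ (u +ₚ v) *ₚ w)
      ≈⟨ +ₚ-cong (scaleₚ-distribʳ a b w) (∷-cong refl (*ₚ-distribʳ w u v)) ⟩
    (scaleₚ a w +ₚ scaleₚ b w) +ₚ ((0ℚ ∷ u *ₚ w) +ₚ (0ℚ ∷ v *ₚ w))
      ≈⟨ +ₚ-interchange (scaleₚ a w) (scaleₚ b w) _ _ ⟩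
    (scaleₚ a w +ₚ (0ℚ ∷ u *ₚ w)) +ₚ (scaleₚ b w +ₚ (0ℚ ∷ v *ₚ w))
      ∎

  *ₚ-assoc : ∀ p q r → (p *ₚ q) *ₚ r ≈ₚ p *ₚ (q *ₚ r)
  *ₚ-assoc []      q r = ≈ₚ-refl
  *ₚ-assoc (a ∷ p) q r = begin
    (scaleₚ a q +ₚ (0ℚ ∷ p *ₚ q)) *ₚ r         ≈⟨ *ₚ-distribʳ r (scaleₚ a q) _ ⟩
    scaleₚ a q *ₚ r +ₚ (0ℚ ∷ p *ₚ q) *ₚ r      ≈⟨ +ₚ-cong (scaleₚ-*ₚ a q r) (0∷-*ₚ (p *ₚ q) r) ⟩
    scaleₚ a (q *ₚ r) +ₚ (0ℚ ∷ (p *ₚ q) *ₚ r)  ≈⟨ +ₚ-congˡ (scaleₚ a (q *ₚ r)) (∷-cong refl (*ₚ-assoc p q r)) ⟩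
    scaleₚ a (q *ₚ r) +ₚ (0ℚ ∷ p *ₚ (q *ₚ r))  ∎

  *ₚ-identityˡ : ∀ p → constₚ 1ℚ *ₚ p ≈ₚ p
  *ₚ-identityˡ p = begin
    scaleₚ 1ℚ p +ₚ (0ℚ ∷ []) ≈⟨ +ₚ-congˡ (scaleₚ 1ℚ p) 0∷[]≈ₚ[] ⟩
    scaleₚ 1ℚ p +ₚ []        ≈⟨ +ₚ-identityʳ (scaleₚ 1ℚ p) ⟩
    scaleₚ 1ℚ p              ≈⟨ scaleₚ-identity p ⟩
    p                        ∎

  Poly-isCommutativeRing : Structures.IsCommutativeRing _≈ₚ_ _+ₚ_ _*ₚ_ -ₚ_ [] (constₚ 1ℚ)
  Poly-isCommutativeRing = record
    { isRing = record
      { +-isAbelianGroup = record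
        { isGroup = record
          { isMonoid = Structures.IsCommutativeMonoid.isMonoid +ₚ-isCommutativeMonoid
          ; inverse  = comm∧invˡ⇒inv ≈ₚ-setoid +ₚ-comm -ₚ‿inverseˡ
          ; ⁻¹-cong  = -ₚ‿cong
          }
        ; comm = +ₚ-comm
        }
      ; *-cong     = λ {p} {p′} {q} p≈p′ q≈q′ → ≈ₚ-trans (*ₚ-congˡ q p≈p′) (*ₚ-congʳ p′ q≈q′)
      ; *-assoc    = *ₚ-assoc
      ; *-identity = comm∧idˡ⇒id ≈ₚ-setoid *ₚ-comm *ₚ-identityˡ
      ; distrib    = comm∧distrʳ⇒distr ≈ₚ-setoid +ₚ-cong *ₚ-comm *ₚ-distribʳ
      }
    ; *-comm = *ₚ-comm
    }

  Poly-commutativeRing : CommutativeRing 0ℓ 0ℓ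
  Poly-commutativeRing = record { isCommutativeRing = Poly-isCommutativeRing }

constₚ-isRingHomomorphism :
  RingMorphisms.IsRingHomomorphism ℚP.+-*-rawRing (CommutativeRing.rawRing Poly-commutativeRing) constₚ
constₚ-isRingHomomorphism = record
  { isSemiringHomomorphism = record
    { isNearSemiringHomomorphism = record
      { +-isMonoidHomomorphism = record
        { isMagmaHomomorphism = record
          { isRelHomomorphism = record { cong = λ a≡b → ∷-cong a≡b ≈ₚ-refl }
          ; homo              = λ _ _ → ≈ₚ-refl
          }
        ; ε-homo = 0∷[]≈ₚ[]
        }
      ; *-homo = λ a b → ∷-cong (≡.sym (ℚP.+-identityʳ (a ℚ.* b))) ≈ₚ-refl
      }
    ; 1#-homo = ≈ₚ-refl
    }
  ; -‿homo = λ _ → ≈ₚ-refl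
  }

-- Evaluation in a commutative ring over ℚ

-- For R = cring K, eval is evalK K; for R = Poly-commutativeRing and
-- ι = constₚ, eval p s is p ∘ₚ s (both definitionally).
module Evaluation {c ℓ} (R : CommutativeRing c ℓ) (ι : ℚ → CommutativeRing.Carrier R)
                  (ι-hom : RingMorphisms.IsRingHomomorphism ℚP.+-*-rawRing (CommutativeRing.rawRing R) ι) where
  open CommutativeRing R
  open RingMorphisms.IsRingHomomorphism ι-hom
  open SetoidReasoning setoid
  open CommutativeSemigroupProperties +-commutativeSemigroup using (interchange)
  open CommutativeSemigroupProperties *-commutativeSemigroup using (x∙yz≈y∙xz)

  eval : Poly → Carrier → Carrier
  eval p t = foldr (λ c acc → ι c + t * acc) 0# p

  eval-congʳ : ∀ p {s t} → s ≈ t → eval p s ≈ eval p t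
  eval-congʳ []      s≈t = refl
  eval-congʳ (c ∷ p) s≈t = +-congˡ (*-cong s≈t (eval-congʳ p s≈t))

  eval-≈ₚ[] : ∀ {p} t → p ≈ₚ [] → eval p t ≈ 0#
  eval-≈ₚ[] {[]}    t _             = refl
  eval-≈ₚ[] {c ∷ p} t (coeffwise e) = begin
    ι c + t * eval p t ≈⟨ +-cong (⟦⟧-cong (e 0)) (*-congˡ (eval-≈ₚ[] {p} t (coeffwise (e ∘ suc)))) ⟩
    ι 0ℚ + t * 0#      ≈⟨ +-cong 0#-homo (zeroʳ t) ⟩
    0# + 0#            ≈⟨ +-identityʳ 0# ⟩
    0#                 ∎

  eval-congˡ : ∀ {p q} t → p ≈ₚ q → eval p t ≈ eval q t
  eval-congˡ {[]}    {q}     t p≈q           = sym (eval-≈ₚ[] t (≈ₚ-sym p≈q))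
  eval-congˡ {c ∷ p} {[]}    t p≈q           = eval-≈ₚ[] t p≈q
  eval-congˡ {a ∷ p} {b ∷ q} t (coeffwise e) =
    +-cong (⟦⟧-cong (e 0)) (*-congˡ (eval-congˡ {p} {q} t (coeffwise (e ∘ suc))))

  eval-constₚ : ∀ c t → eval (constₚ c) t ≈ ι c
  eval-constₚ c t = trans (+-congˡ (zeroʳ t)) (+-identityʳ (ι c))

  eval-+ₚ : ∀ p q t → eval (p +ₚ q) t ≈ eval p t + eval q t
  eval-+ₚ []      q       t = sym (+-identityˡ (eval q t))
  eval-+ₚ (a ∷ p) []      t = sym (+-identityʳ (eval (a ∷ p) t))
  eval-+ₚ (a ∷ p) (b ∷ q) t = begin
    ι (a ℚ.+ b) + t * eval (p +ₚ q) t              ≈⟨ +-cong (+-homo a b) (*-congˡ (eval-+ₚ p q t)) ⟩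
    (ι a + ι b) + t * (eval p t + eval q t)        ≈⟨ +-congˡ (distribˡ t (eval p t) (eval q t)) ⟩
    (ι a + ι b) + (t * eval p t + t * eval q t)    ≈⟨ interchange (ι a) (ι b) _ _ ⟩
    (ι a + t * eval p t) + (ι b + t * eval q t)    ∎

  eval-scaleₚ : ∀ c p t → eval (scaleₚ c p) t ≈ ι c * eval p t
  eval-scaleₚ c []      t = sym (zeroʳ (ι c))
  eval-scaleₚ c (a ∷ p) t = begin
    ι (c ℚ.* a) + t * eval (scaleₚ c p) t  ≈⟨ +-cong (*-homo c a) (*-congˡ (eval-scaleₚ c p t)) ⟩
    ι c * ι a + t * (ι c * eval p t)       ≈⟨ +-congˡ (x∙yz≈y∙xz t (ι c) (eval p t)) ⟩
    ι c * ι a + ι c * (t * eval p t)       ≈⟨ distribˡ (ι c) (ι a) _ ⟨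
    ι c * (ι a + t * eval p t)             ∎

  eval-*ₚ : ∀ p q t → eval (p *ₚ q) t ≈ eval p t * eval q t
  eval-*ₚ []      q t = sym (zeroˡ (eval q t))
  eval-*ₚ (a ∷ p) q t = begin
    eval (scaleₚ a q +ₚ (0ℚ ∷ p *ₚ q)) t
      ≈⟨ eval-+ₚ (scaleₚ a q) (0ℚ ∷ p *ₚ q) t ⟩
    eval (scaleₚ a q) t + (ι 0ℚ + t * eval (p *ₚ q) t)
      ≈⟨ +-cong (eval-scaleₚ a q t) (+-cong 0#-homo (*-congˡ (eval-*ₚ p q t))) ⟩
    ι a * eval q t + (0# + t * (eval p t * eval q t))
      ≈⟨ +-congˡ (trans (+-identityˡ _) (sym (*-assoc t (eval p t) (eval q t)))) ⟩
    ι a * eval q t + (t * eval p t) * eval q t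
      ≈⟨ distribʳ (eval q t) (ι a) (t * eval p t) ⟨
    (ι a + t * eval p t) * eval q t
      ∎

  eval-∘ₚ : ∀ p s t → eval (p ∘ₚ s) t ≈ eval p (eval s t)
  eval-∘ₚ []      s t = refl
  eval-∘ₚ (c ∷ p) s t = begin
    eval (constₚ c +ₚ s *ₚ (p ∘ₚ s)) t               ≈⟨ eval-+ₚ (constₚ c) (s *ₚ (p ∘ₚ s)) t ⟩
    eval (constₚ c) t + eval (s *ₚ (p ∘ₚ s)) t       ≈⟨ +-cong (eval-constₚ c t) (eval-*ₚ s (p ∘ₚ s) t) ⟩
    ι c + eval s t * eval (p ∘ₚ s) t                 ≈⟨ +-congˡ (*-congˡ (eval-∘ₚ p s t)) ⟩
    ι c + eval s t * eval p (eval s t)               ∎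

  eval-linearₚ : ∀ a b t → eval (linearₚ a b) t ≈ ι a * t + ι b
  eval-linearₚ a b t = begin
    ι b + t * eval (constₚ a) t ≈⟨ +-congˡ (*-congˡ (eval-constₚ a t)) ⟩
    ι b + t * ι a               ≈⟨ +-comm (ι b) (t * ι a) ⟩
    t * ι a + ι b               ≈⟨ +-congʳ (*-comm t (ι a)) ⟩
    ι a * t + ι b               ∎

  eval-Xₚ : ∀ t → eval Xₚ t ≈ t
  eval-Xₚ t = begin
    eval (linearₚ 1ℚ 0ℚ) t ≈⟨ eval-linearₚ 1ℚ 0ℚ t ⟩
    ι 1ℚ * t + ι 0ℚ        ≈⟨ +-cong (*-congʳ 1#-homo) 0#-homo ⟩
    1# * t + 0#            ≈⟨ +-identityʳ (1# * t) ⟩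
    1# * t                 ≈⟨ *-identityˡ t ⟩
    t                      ∎

open Evaluation Poly-commutativeRing constₚ constₚ-isRingHomomorphism public
  using ()
  renaming ( eval-congˡ to ∘ₚ-congˡ; eval-congʳ to ∘ₚ-congʳ; eval-*ₚ to *ₚ-∘ₚ
           ; eval-∘ₚ to ∘ₚ-assoc; eval-linearₚ to linearₚ-∘ₚ)

module ≈ₚ-Reasoning = SetoidReasoning ≈ₚ-setoid

constₚ-*ₚ : ∀ a p → constₚ a *ₚ p ≈ₚ scaleₚ a p
constₚ-*ₚ a p = ≈ₚ-trans (+ₚ-congˡ (scaleₚ a p) 0∷[]≈ₚ[]) (+ₚ-identityʳ (scaleₚ a p))

∘ₚ-identityʳ : ∀ p → p ∘ₚ Xₚ ≈ₚ p
∘ₚ-identityʳ []      = ≈ₚ-refl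
∘ₚ-identityʳ (c ∷ p) = begin
  constₚ c +ₚ Xₚ *ₚ (p ∘ₚ Xₚ)                  ≈⟨ +ₚ-congˡ (constₚ c) (0∷-*ₚ (constₚ 1ℚ) (p ∘ₚ Xₚ)) ⟩
  constₚ c +ₚ (0ℚ ∷ constₚ 1ℚ *ₚ (p ∘ₚ Xₚ))    ≈⟨ ∷-cong (ℚP.+-identityʳ c) (*ₚ-identityˡ (p ∘ₚ Xₚ)) ⟩
  c ∷ p ∘ₚ Xₚ                                   ≈⟨ ∷-cong ≡.refl (∘ₚ-identityʳ p) ⟩
  c ∷ p                                         ∎
  where open ≈ₚ-Reasoning

constₚ-∘ₚ : ∀ c f s → f ≈ₚ [] → (c ∷ f) ∘ₚ s ≈ₚ constₚ c
constₚ-∘ₚ c f s f≈[] = begin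
  constₚ c +ₚ s *ₚ (f ∘ₚ s) ≈⟨ +ₚ-congˡ (constₚ c) (*ₚ-congʳ s (∘ₚ-congˡ s f≈[])) ⟩
  constₚ c +ₚ s *ₚ []       ≈⟨ +ₚ-congˡ (constₚ c) (*ₚ-zeroʳ s) ⟩
  constₚ c +ₚ []            ≈⟨ +ₚ-identityʳ (constₚ c) ⟩
  constₚ c                  ∎
  where open ≈ₚ-Reasoning

-- Linear substitution: degrees and irreducibility

module _ where
  open import Data.Rational using (_+_; _*_; 1/_; ≢-nonZero)
  open import Data.Nat using (_<_; s≤s; z≤n)
  open import Data.Nat.Properties using (m<n⇒m<1+n; n<1+n)
  open import Algebra.Definitions.RawSemiring ℚP.+-*-rawSemiring using (_^_)
  open ≡ using (refl; sym; trans; cong; cong₂; _≢_)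
  open ≡.≡-Reasoning

  *-≢0 : ∀ {p q} → p ≢ 0ℚ → q ≢ 0ℚ → p * q ≢ 0ℚ
  *-≢0 {p} {q} p≢0 q≢0 pq≡0 = q≢0 (begin
    q              ≡⟨ ℚP.*-identityˡ q ⟨
    1ℚ * q         ≡⟨ cong (_* q) (ℚP.*-inverseˡ p) ⟨
    (1/ p * p) * q ≡⟨ ℚP.*-assoc (1/ p) p q ⟩
    1/ p * (p * q) ≡⟨ cong (1/ p *_) pq≡0 ⟩
    1/ p * 0ℚ      ≡⟨ ℚP.*-zeroʳ (1/ p) ⟩
    0ℚ             ∎)
    where instance _ = ≢-nonZero p≢0

  ^-≢0 : ∀ {p} → p ≢ 0ℚ → ∀ n → p ^ n ≢ 0ℚ
  ^-≢0 p≢0 zero    ()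
  ^-≢0 p≢0 (suc n) = *-≢0 p≢0 (^-≢0 p≢0 n)

  DegreeAtMost : Poly → ℕ → Set
  DegreeAtMost p n = ∀ k → n < k → coeff p k ≡ 0ℚ

  coeff-∷-∘ₚ-linearₚ : ∀ a b c f k →
    coeff ((c ∷ f) ∘ₚ linearₚ a b) (suc k) ≡
    a * coeff (f ∘ₚ linearₚ a b) k + b * coeff (f ∘ₚ linearₚ a b) (suc k)
  coeff-∷-∘ₚ-linearₚ a b c f k = begin
    coeff (constₚ c +ₚ linearₚ a b *ₚ P) (suc k)       ≡⟨ coeff-+ₚ (constₚ c) (linearₚ a b *ₚ P) (suc k) ⟩
    0ℚ + coeff (scaleₚ b P +ₚ (0ℚ ∷ constₚ a *ₚ P)) (suc k)
                                                       ≡⟨ ℚP.+-identityˡ _ ⟩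
    coeff (scaleₚ b P +ₚ (0ℚ ∷ constₚ a *ₚ P)) (suc k) ≡⟨ coeff-+ₚ (scaleₚ b P) (0ℚ ∷ constₚ a *ₚ P) (suc k) ⟩
    coeff (scaleₚ b P) (suc k) + coeff (constₚ a *ₚ P) k
      ≡⟨ cong₂ _+_ (coeff-scaleₚ b P (suc k)) (trans (coeff≡ (constₚ-*ₚ a P) k) (coeff-scaleₚ a P k)) ⟩
    b * coeff P (suc k) + a * coeff P k                ≡⟨ ℚP.+-comm (b * coeff P (suc k)) (a * coeff P k) ⟩
    a * coeff P k + b * coeff P (suc k)                ∎
    where P = f ∘ₚ linearₚ a b

  ∘ₚ-linearₚ-degree : ∀ a b f m → DegreeAtMost f m →
    DegreeAtMost (f ∘ₚ linearₚ a b) m × coeff (f ∘ₚ linearₚ a b) m ≡ a ^ m * coeff f m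
  ∘ₚ-linearₚ-degree a b []      m       _    = (λ _ _ → refl) , sym (ℚP.*-zeroʳ (a ^ m))
  ∘ₚ-linearₚ-degree a b (c ∷ f) zero    f≤0  =
    (λ { (suc k) _ → coeff≡ c∷f∘L≈c (suc k) }) , trans (coeff≡ c∷f∘L≈c 0) (sym (ℚP.*-identityˡ c))
    where
    c∷f∘L≈c : (c ∷ f) ∘ₚ linearₚ a b ≈ₚ constₚ c
    c∷f∘L≈c = constₚ-∘ₚ c f (linearₚ a b) (coeffwise λ k → f≤0 (suc k) (s≤s z≤n))
  ∘ₚ-linearₚ-degree a b (c ∷ f) (suc m) f≤1+m = bound , top
    where
    P = f ∘ₚ linearₚ a b
    ih = ∘ₚ-linearₚ-degree a b f m (λ k m<k → f≤1+m (suc k) (s≤s m<k))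
    bound : DegreeAtMost ((c ∷ f) ∘ₚ linearₚ a b) (suc m)
    bound (suc k) (s≤s m<k) = begin
      coeff ((c ∷ f) ∘ₚ linearₚ a b) (suc k) ≡⟨ coeff-∷-∘ₚ-linearₚ a b c f k ⟩
      a * coeff P k + b * coeff P (suc k)
        ≡⟨ cong₂ (λ u v → a * u + b * v) (proj₁ ih k m<k) (proj₁ ih (suc k) (m<n⇒m<1+n m<k)) ⟩
      a * 0ℚ + b * 0ℚ                        ≡⟨ cong₂ _+_ (ℚP.*-zeroʳ a) (ℚP.*-zeroʳ b) ⟩
      0ℚ                                     ∎
    top : coeff ((c ∷ f) ∘ₚ linearₚ a b) (suc m) ≡ a ^ suc m * coeff f m
    top = begin
      coeff ((c ∷ f) ∘ₚ linearₚ a b) (suc m) ≡⟨ coeff-∷-∘ₚ-linearₚ a b c f m ⟩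
      a * coeff P m + b * coeff P (suc m)
        ≡⟨ cong₂ (λ u v → a * u + b * v) (proj₂ ih) (proj₁ ih (suc m) (n<1+n m)) ⟩
      a * (a ^ m * coeff f m) + b * 0ℚ       ≡⟨ cong (a * (a ^ m * coeff f m) +_) (ℚP.*-zeroʳ b) ⟩
      a * (a ^ m * coeff f m) + 0ℚ           ≡⟨ ℚP.+-identityʳ _ ⟩
      a * (a ^ m * coeff f m)                ≡⟨ ℚP.*-assoc a (a ^ m) (coeff f m) ⟨
      a ^ suc m * coeff f m                  ∎

  Degree-∘ₚ-linearₚ : ∀ {a} b f m → a ≢ 0ℚ → Degree f m → Degree (f ∘ₚ linearₚ a b) m
  Degree-∘ₚ-linearₚ {a} b f m a≢0 (fₘ≢0 , f≤m) =
    (λ eq → *-≢0 (^-≢0 a≢0 m) fₘ≢0 (trans (sym (proj₂ degree)) eq)) , proj₁ degree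
    where degree = ∘ₚ-linearₚ-degree a b f m f≤m

  Degree-linearₚ-∘ₚ : ∀ {a} b s m → a ≢ 0ℚ → Degree s (suc m) → Degree (linearₚ a b ∘ₚ s) (suc m)
  Degree-linearₚ-∘ₚ {a} b s m a≢0 (sₘ≢0 , s≤m) =
    (λ eq → *-≢0 a≢0 sₘ≢0 (trans (sym (coeff-suc m)) eq)) ,
    λ { (suc k) m<k → trans (coeff-suc k) (trans (cong (a *_) (s≤m (suc k) m<k)) (ℚP.*-zeroʳ a)) }
    where
    coeff-suc : ∀ k → coeff (linearₚ a b ∘ₚ s) (suc k) ≡ a * coeff s (suc k)
    coeff-suc k = begin
      coeff (linearₚ a b ∘ₚ s) (suc k)                  ≡⟨ coeff≡ (linearₚ-∘ₚ a b s) (suc k) ⟩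
      coeff (constₚ a *ₚ s +ₚ constₚ b) (suc k)         ≡⟨ coeff-+ₚ (constₚ a *ₚ s) (constₚ b) (suc k) ⟩
      coeff (constₚ a *ₚ s) (suc k) + 0ℚ                ≡⟨ ℚP.+-identityʳ _ ⟩
      coeff (constₚ a *ₚ s) (suc k)                     ≡⟨ coeff≡ (constₚ-*ₚ a s) (suc k) ⟩
      coeff (scaleₚ a s) (suc k)                        ≡⟨ coeff-scaleₚ a s (suc k) ⟩
      a * coeff s (suc k)                               ∎

module LinearChange (α β : ℚ) (α≢0 : ¬ (α ≡ 0ℚ)) where
  open import Data.Rational using (_+_; _*_; -_; 1/_; ≢-nonZero)
  open ≡ using (refl; sym; trans; cong)

  private instance
    α-nonZero : ℚ.NonZero α
    α-nonZero = ≢-nonZero α≢0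

  α⁻¹ : ℚ
  α⁻¹ = 1/ α

  α⁻¹≢0 : ¬ (α⁻¹ ≡ 0ℚ)
  α⁻¹≢0 α⁻¹≡0 with trans (sym (ℚP.*-inverseʳ α)) (trans (cong (α *_) α⁻¹≡0) (ℚP.*-zeroʳ α))
  ... | ()

  β′ : ℚ
  β′ = - (α⁻¹ * β)

  L L⁻¹ : Poly
  L   = linearₚ α β
  L⁻¹ = linearₚ α⁻¹ β′

  L∘L⁻¹ : L ∘ₚ L⁻¹ ≈ₚ Xₚ
  L∘L⁻¹ = ≈ₚ-trans (linearₚ-∘ₚ α β L⁻¹) (coeffwise λ where
    zero          → constant-term
    (suc zero)    → ℚP.*-inverseʳ α
    (suc (suc n)) → refl)
    where
    open ≡.≡-Reasoning
    constant-term : (α * - (α⁻¹ * β) + 0ℚ) + β ≡ 0ℚ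
    constant-term = begin
      (α * - (α⁻¹ * β) + 0ℚ) + β ≡⟨ cong (_+ β) (ℚP.+-identityʳ (α * - (α⁻¹ * β))) ⟩
      α * - (α⁻¹ * β) + β        ≡⟨ cong (_+ β) (ℚP.neg-distribʳ-* α (α⁻¹ * β)) ⟨
      - (α * (α⁻¹ * β)) + β      ≡⟨ cong (λ u → - u + β) (ℚP.*-assoc α α⁻¹ β) ⟨
      - ((α * α⁻¹) * β) + β      ≡⟨ cong (λ u → - (u * β) + β) (ℚP.*-inverseʳ α) ⟩
      - (1ℚ * β) + β             ≡⟨ cong (λ u → - u + β) (ℚP.*-identityˡ β) ⟩
      - β + β                    ≡⟨ ℚP.+-inverseˡ β ⟩
      0ℚ                         ∎

  ∘L∘L⁻¹ : ∀ p → (p ∘ₚ L) ∘ₚ L⁻¹ ≈ₚ p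
  ∘L∘L⁻¹ p = begin
    (p ∘ₚ L) ∘ₚ L⁻¹ ≈⟨ ∘ₚ-assoc p L L⁻¹ ⟩
    p ∘ₚ (L ∘ₚ L⁻¹) ≈⟨ ∘ₚ-congʳ p L∘L⁻¹ ⟩
    p ∘ₚ Xₚ         ≈⟨ ∘ₚ-identityʳ p ⟩
    p               ∎
    where open ≈ₚ-Reasoning

  Degree-∘L : ∀ f m → Degree f m → Degree (f ∘ₚ L) m
  Degree-∘L f m = Degree-∘ₚ-linearₚ β f m α≢0

  conj : Poly → Poly
  conj q = L⁻¹ ∘ₚ (q ∘ₚ L)

  Degree-conj : ∀ q m → Degree q (suc m) → Degree (conj q) (suc m)
  Degree-conj q m deg = Degree-linearₚ-∘ₚ β′ (q ∘ₚ L) m α⁻¹≢0 (Degree-∘L q (suc m) deg)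

  Irreducible-∘L : ∀ p → Irreducible p → Irreducible (p ∘ₚ L)
  Irreducible-∘L p ((d , deg-p) , factors-p) = (d , Degree-∘L p (suc d) deg-p) , factors-p∘L
    where
    factors-p∘L : ∀ f g m n → Degree f m → Degree g n → (p ∘ₚ L) ≐ (f *ₚ g) → m ≡ 0 ⊎ n ≡ 0
    factors-p∘L f g m n deg-f deg-g p∘L≐fg =
      factors-p (f ∘ₚ L⁻¹) (g ∘ₚ L⁻¹) m n
        (Degree-∘ₚ-linearₚ β′ f m α⁻¹≢0 deg-f) (Degree-∘ₚ-linearₚ β′ g n α⁻¹≢0 deg-g) (coeff≡ (begin
          p                             ≈⟨ ∘L∘L⁻¹ p ⟨
          (p ∘ₚ L) ∘ₚ L⁻¹               ≈⟨ ∘ₚ-congˡ {p ∘ₚ L} {f *ₚ g} L⁻¹ (coeffwise p∘L≐fg) ⟩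
          (f *ₚ g) ∘ₚ L⁻¹               ≈⟨ *ₚ-∘ₚ f g L⁻¹ ⟩
          (f ∘ₚ L⁻¹) *ₚ (g ∘ₚ L⁻¹)      ∎))
      where open ≈ₚ-Reasoning

-- Roots and Galois groups under linear substitution

module _ (K : FieldOverℚ) where
  open FieldOverℚ K
  open RingMorphisms.IsRingHomomorphism ι-hom using (0#-homo; 1#-homo; *-homo)
  open Evaluation cring ι ι-hom
  open import Algebra.Definitions.RawSemiring (Semiring.rawSemiring semiring) using (_^_)
  open import Algebra.Definitions.RawSemiring ℚP.+-*-rawSemiring using () renaming (_^_ to _^ℚ_)
  open CommutativeSemigroupProperties +-commutativeSemigroup using () renaming (interchange to +-interchange)
  open CommutativeSemigroupProperties *-commutativeSemigroup
    using (x∙yz≈y∙xz) renaming (interchange to *-interchange)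
  open import Algebra.Properties.AbelianGroup +-abelianGroup using (⁻¹-∙-comm)
  open import Algebra.Properties.Ring (CommutativeRing.ring cring) using (x[y-z]≈xy-xz)
  open SetoidReasoning setoid

  ι-^ : ∀ a n → ι (a ^ℚ n) ≈ ι a ^ n
  ι-^ a zero    = 1#-homo
  ι-^ a (suc n) = trans (*-homo a (a ^ℚ n)) (*-congˡ (ι-^ a n))

  ∏₃ : (Fin 3 → Carrier) → Carrier
  ∏₃ f = (f 0F * f 1F) * f 2F

  ∏₃-cong : ∀ {f g} → (∀ i → f i ≈ g i) → ∏₃ f ≈ ∏₃ g
  ∏₃-cong f≈g = *-cong (*-cong (f≈g 0F) (f≈g 1F)) (f≈g 2F)

  ∏₃-scale : ∀ a f → ∏₃ (λ i → a * f i) ≈ a ^ 3 * ∏₃ f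
  ∏₃-scale a f = begin
    ((a * f 0F) * (a * f 1F)) * (a * f 2F)   ≈⟨ *-congʳ (*-interchange a (f 0F) a (f 1F)) ⟩
    ((a * a) * (f 0F * f 1F)) * (a * f 2F)   ≈⟨ *-interchange (a * a) _ a (f 2F) ⟩
    ((a * a) * a) * ∏₃ f                     ≈⟨ *-congʳ (*-assoc a a a) ⟩
    (a * (a * a)) * ∏₃ f                     ≈⟨ *-congʳ (*-congˡ (*-congˡ (*-identityʳ a))) ⟨
    a ^ 3 * ∏₃ f                             ∎

  RootsOf-∘ₚ-linearₚ : ∀ a b p x y → DegreeAtMost p 3 →
    (∀ i → x i ≈ eval (linearₚ a b) (y i)) → RootsOf K p x → RootsOf K (p ∘ₚ linearₚ a b) y
  RootsOf-∘ₚ-linearₚ a b p x y p≤3 x≈L[y] roots t = begin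
    eval (p ∘ₚ L) t                                  ≈⟨ eval-∘ₚ p L t ⟩
    eval p (eval L t)                                ≈⟨ roots (eval L t) ⟩
    ι (coeff p 3) * ∏₃ (λ i → eval L t - x i)        ≈⟨ *-congˡ (∏₃-cong shift) ⟩
    ι (coeff p 3) * ∏₃ (λ i → ι a * (t - y i))       ≈⟨ *-congˡ (∏₃-scale (ι a) (λ i → t - y i)) ⟩
    ι (coeff p 3) * (ι a ^ 3 * ∏₃ (λ i → t - y i))   ≈⟨ x∙yz≈y∙xz (ι (coeff p 3)) (ι a ^ 3) _ ⟩
    ι a ^ 3 * (ι (coeff p 3) * ∏₃ (λ i → t - y i))   ≈⟨ *-assoc (ι a ^ 3) (ι (coeff p 3)) _ ⟨
    (ι a ^ 3 * ι (coeff p 3)) * ∏₃ (λ i → t - y i)   ≈⟨ *-congʳ leading ⟨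
    ι (coeff (p ∘ₚ L) 3) * ∏₃ (λ i → t - y i)        ∎
    where
    L = linearₚ a b
    shift : ∀ i → eval L t - x i ≈ ι a * (t - y i)
    shift i = begin
      eval L t - x i
        ≈⟨ +-cong (eval-linearₚ a b t) (-‿cong (trans (x≈L[y] i) (eval-linearₚ a b (y i)))) ⟩
      (ι a * t + ι b) - (ι a * y i + ι b)        ≈⟨ +-congˡ (⁻¹-∙-comm (ι a * y i) (ι b)) ⟨
      (ι a * t + ι b) + (- (ι a * y i) + - ι b)  ≈⟨ +-interchange (ι a * t) (ι b) _ _ ⟩
      (ι a * t - ι a * y i) + (ι b - ι b)        ≈⟨ +-congˡ (-‿inverseʳ (ι b)) ⟩
      (ι a * t - ι a * y i) + 0#                 ≈⟨ +-identityʳ _ ⟩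
      ι a * t - ι a * y i                        ≈⟨ x[y-z]≈xy-xz (ι a) t (y i) ⟨
      ι a * (t - y i)                            ∎
    leading : ι (coeff (p ∘ₚ L) 3) ≈ ι a ^ 3 * ι (coeff p 3)
    leading = begin
      ι (coeff (p ∘ₚ L) 3)        ≡⟨ ≡.cong ι (proj₂ (∘ₚ-linearₚ-degree a b p 3 p≤3)) ⟩
      ι (a ^ℚ 3 ℚ.* coeff p 3)    ≈⟨ *-homo (a ^ℚ 3) (coeff p 3) ⟩
      ι (a ^ℚ 3) * ι (coeff p 3)  ≈⟨ *-congʳ (ι-^ a 3) ⟩
      ι a ^ 3 * ι (coeff p 3)     ∎

  horner : Poly → MExpr K → MExpr K
  horner []      e = cst 0ℚ
  horner (c ∷ p) e = cst c ⊕ (e ⊗ horner p e)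

  _∘ᴹ_ : MExpr K → Poly → MExpr K
  cst c   ∘ᴹ s = cst c
  var i   ∘ᴹ s = horner s (var i)
  (F ⊕ G) ∘ᴹ s = (F ∘ᴹ s) ⊕ (G ∘ᴹ s)
  (F ⊗ G) ∘ᴹ s = (F ∘ᴹ s) ⊗ (G ∘ᴹ s)

  evalM-cong : ∀ {x y} → (∀ i → x i ≈ y i) → ∀ F → evalM K x F ≈ evalM K y F
  evalM-cong x≈y (cst c) = refl
  evalM-cong x≈y (var i) = x≈y i
  evalM-cong x≈y (F ⊕ G) = +-cong (evalM-cong x≈y F) (evalM-cong x≈y G)
  evalM-cong x≈y (F ⊗ G) = *-cong (evalM-cong x≈y F) (evalM-cong x≈y G)

  evalM-horner : ∀ x p e → evalM K x (horner p e) ≈ eval p (evalM K x e)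
  evalM-horner x []      e = 0#-homo
  evalM-horner x (c ∷ p) e = +-congˡ (*-congˡ (evalM-horner x p e))

  evalM-∘ᴹ : ∀ x s F → evalM K x (F ∘ᴹ s) ≈ evalM K (λ i → eval s (x i)) F
  evalM-∘ᴹ x s (cst c) = refl
  evalM-∘ᴹ x s (var i) = evalM-horner x s (var i)
  evalM-∘ᴹ x s (F ⊕ G) = +-cong (evalM-∘ᴹ x s F) (evalM-∘ᴹ x s G)
  evalM-∘ᴹ x s (F ⊗ G) = *-cong (evalM-∘ᴹ x s F) (evalM-∘ᴹ x s G)

  -- A relation F(w) = 0 among the images w = s(z) is the relation
  -- (F ∘ᴹ s)(z) = 0 among the z.
  InGalois-polyImage : ∀ s z w σ → (∀ i → w i ≈ eval s (z i)) → InGalois K z σ → InGalois K w σ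
  InGalois-polyImage s z w σ w≈s[z] z-galois F F[w]≈0 = begin
    evalM K (λ i → w (σ ⟨$⟩ʳ i)) F             ≈⟨ evalM-cong (λ i → w≈s[z] (σ ⟨$⟩ʳ i)) F ⟩
    evalM K (λ i → eval s (z (σ ⟨$⟩ʳ i))) F    ≈⟨ evalM-∘ᴹ (λ i → z (σ ⟨$⟩ʳ i)) s F ⟨
    evalM K (λ i → z (σ ⟨$⟩ʳ i)) (F ∘ᴹ s)      ≈⟨ z-galois (F ∘ᴹ s) F∘s[z]≈0 ⟩
    0#                                          ∎
    where
    F∘s[z]≈0 : evalM K z (F ∘ᴹ s) ≈ 0#
    F∘s[z]≈0 = begin
      evalM K z (F ∘ᴹ s)                 ≈⟨ evalM-∘ᴹ z s F ⟩
      evalM K (λ i → eval s (z i)) F     ≈⟨ evalM-cong w≈s[z] F ⟨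
      evalM K w F                        ≈⟨ F[w]≈0 ⟩
      0#                                 ∎

module LinearChangeOfRoots (K : FieldOverℚ) (α β : ℚ) (α≢0 : ¬ (α ≡ 0ℚ)) where
  open FieldOverℚ K
  open Evaluation cring ι ι-hom
  open LinearChange α β α≢0 public
  open SetoidReasoning setoid

  eval-L∘L⁻¹ : ∀ t → t ≈ eval L (eval L⁻¹ t)
  eval-L∘L⁻¹ t = begin
    t                   ≈⟨ eval-Xₚ t ⟨
    eval Xₚ t           ≈⟨ eval-congˡ t L∘L⁻¹ ⟨
    eval (L ∘ₚ L⁻¹) t   ≈⟨ eval-∘ₚ L L⁻¹ t ⟩
    eval L (eval L⁻¹ t) ∎

  L⁻¹-roots : (Fin 3 → Carrier) → Fin 3 → Carrier
  L⁻¹-roots x i = eval L⁻¹ (x i)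

  RootsOf-∘L : ∀ p x → DegreeAtMost p 3 → RootsOf K p x → RootsOf K (p ∘ₚ L) (L⁻¹-roots x)
  RootsOf-∘L p x p≤3 = RootsOf-∘ₚ-linearₚ K α β p x (L⁻¹-roots x) p≤3 (λ i → eval-L∘L⁻¹ (x i))

  CubicGalois-∘L : ∀ p → CubicGalois K p → CubicGalois K (p ∘ₚ L)
  CubicGalois-∘L p (deg-p , irr-p , x , roots , galois) =
    Degree-∘L p 3 deg-p , Irreducible-∘L p irr-p , y , RootsOf-∘L p x (proj₂ deg-p) roots ,
    λ σ → mk⇔ (λ y-galois → Equivalence.to (galois σ)
                 (InGalois-polyImage K L y x σ (λ i → eval-L∘L⁻¹ (x i)) y-galois))
              (λ σ∈A₃ → InGalois-polyImage K L⁻¹ x y σ (λ i → refl) (Equivalence.from (galois σ) σ∈A₃))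
    where y = L⁻¹-roots x

  CyclicallyPermutes-conj : ∀ q p → Degree p 3 →
    CyclicallyPermutes K q p → CyclicallyPermutes K (conj q) (p ∘ₚ L)
  CyclicallyPermutes-conj q p deg-p (x , roots , q-cycles) =
    L⁻¹-roots x , RootsOf-∘L p x (proj₂ deg-p) roots , λ i → begin
      eval (conj q) (eval L⁻¹ (x i))              ≈⟨ eval-∘ₚ L⁻¹ (q ∘ₚ L) (eval L⁻¹ (x i)) ⟩
      eval L⁻¹ (eval (q ∘ₚ L) (eval L⁻¹ (x i)))   ≈⟨ eval-congʳ L⁻¹ (eval-∘ₚ q L (eval L⁻¹ (x i))) ⟩
      eval L⁻¹ (eval q (eval L (eval L⁻¹ (x i)))) ≈⟨ eval-congʳ L⁻¹ (eval-congʳ q (eval-L∘L⁻¹ (x i))) ⟨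
      eval L⁻¹ (eval q (x i))                     ≈⟨ eval-congʳ L⁻¹ (q-cycles i) ⟩
      eval L⁻¹ (x (next i))                       ∎

proposition3 : (K : FieldOverℚ) (p r : Poly) (α β : ℚ) →
    CubicGalois K p → CubicGalois K r → Coupled K p r → ¬ (α ≡ 0ℚ) →
    CubicGalois K (p ∘ₚ linearₚ α β) × CubicGalois K (r ∘ₚ linearₚ α β) ×
    Coupled K (p ∘ₚ linearₚ α β) (r ∘ₚ linearₚ α β)
proposition3 K p r α β p-galois r-galois (q , deg-q , q-cycles-p , q-cycles-r) α≢0 =
  CubicGalois-∘L p p-galois ,
  CubicGalois-∘L r r-galois ,
  ( conj q
  , Degree-conj q 1 deg-q
  , CyclicallyPermutes-conj q p (proj₁ p-galois) q-cycles-p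
  , CyclicallyPermutes-conj q r (proj₁ r-galois) q-cycles-r )
  where open LinearChangeOfRoots K α β α≢0
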